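{- Let $G$ be a GSOS system and $G^+$ the associated positive preg system. Then for each closed term $p$, closed term $p'$ and action $a$: (1) $p\xrightarrow{a}p'$ in $G$ if and only if $p\xrightarrow{a}p'$ in $G^+$; (2) $p\ \mathrm{cannot}(a)$ holds in $G^+$ if and only if $p$ has no $a$-labelled transition in $G^+$ (and hence in $G$).
   Context: Fix a finite nonempty set of actions $\mathcal{A}$. A preg system is a finite signature with a finite set of rules, each for an $l$-ary operation $f$ with premises of the forms $x_i\xrightarrow{a}y$, $Px_i$, $x_i\not\xrightarrow{b}$, $\neg Qx_i$ on the arguments $x_1,\dots,x_l$ (targets $y$ pairwise distinct fresh variables) and conclusion either $f(x_1,\dots,x_l)\xrightarrow{c}C$ ($C$ a term in those variables) or $P(f(x_1,\dots,x_l))$; transitions and predicates on closed terms are defined by induction on terms: $f(\vec t)$ has the conclusion of a rule instantiated by a closed substitution $\sigma$ with $\sigma(x_i)=t_i$ whenever all its premises are satisfied (positive ones hold; negative ones: no such transition/predicate fails). A GSOS system $G$ is a preg system with no predicates (only transition rules with premises $x_i\xrightarrow{a}y$ and $x_i\not\xrightarrow{b}$); assume every rule for $f$ has source $f(x_1,\dots,x_l)$. $G^+$ has the same signature and actions, predicates $\mathrm{cannot}(a)$ for each $a\in\mathcal{A}$, and rules: (i) each rule of $G$ with every negative premise $x\not\xrightarrow{a}$ replaced by $\mathrm{cannot}(a)\,x$; (ii) for each constant $f$ and action $a$ such that $G$ has no rule with principal operation $f$ and $a$-labelled conclusion, the axiom $\mathrm{cannot}(a)\,f$; (iii) for each $f$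 of arity $\geq1$ and action $a$, letting $R(f,a)$ be the set of rules of $G$ with principal operation $f$ and $a$-labelled conclusion, for every function $\phi$ mapping each $\xi\in R(f,a)$ to one of its premises, the predicate rule with premises $\{\mathrm{neg}(\phi(\xi))\mid\xi\in R(f,a)\}$ and conclusion $\mathrm{cannot}(a)\,f(x_1,\dots,x_l)$, where $\mathrm{neg}(x\xrightarrow{a}x')=\mathrm{cannot}(a)\,x$ and $\mathrm{neg}(x\not\xrightarrow{a})=x\xrightarrow{a}x'$ with the targets $x'$ of these positive premises chosen pairwise distinct and fresh. -}

module Defs where

open import Data.Nat using (ℕ; zero; suc)
open import Data.Fin using (Fin; zero; suc)
open import Data.Fin.Properties using () renaming (_≟_ to _≟F_)
open import Data.Vec using (Vec; []; _∷_)
open import Data.List using (List; []; _∷_; map; _++_; concatMap; length; filter; allFin; null; lookup)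
open import Data.List.Relation.Unary.All using (All)
open import Data.List.Membership.Propositional using (_∈_)
open import Data.Product using (Σ; _×_; _,_; proj₁; proj₂; Σ-syntax)
open import Data.Sum using (_⊎_; inj₁; inj₂; [_,_])
open import Data.Empty using (⊥)
open import Data.Bool using (if_then_else_)
open import Relation.Nullary using (¬_)
open import Relation.Binary.PropositionalEquality using (_≡_)

record Signature : Set where
  field
    nOps  : ℕ
    arity : Fin nOps → ℕ
open Signature public

Act : ℕ → Set
Act nA = Fin (suc nA)

data Term (S : Signature) : Set where
  op : (f : Fin (nOps S)) → Vec (Term S) (arity S f) → Term S

data OTerm (S : Signature) (V : Set) : Set where
  var : V → OTerm S V
  app : (f : Fin (nOps S)) → Vec (OTerm S V) (arity S f) → OTerm S V

mutual
  inst : ∀ {S V} → (V → Term S) → OTerm S V → Term S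
  inst σ (var x)    = σ x
  inst σ (app f ts) = op f (instV σ ts)

  instV : ∀ {S V n} → (V → Term S) → Vec (OTerm S V) n → Vec (Term S) n
  instV σ []       = []
  instV σ (t ∷ ts) = inst σ t ∷ instV σ ts

data Concl (S : Signature) (nA nP : ℕ) (V : Set) : Set where
  trans : Act nA → OTerm S V → Concl S nA nP V
  pred  : Fin nP → Concl S nA nP V

-- Premises:
--   posT : x_i -a-> y_j   (the j-th entry gets its own fresh target variable y_j)
--   posP : P x_i
--   negT : x_i -/b->
--   negP : ¬ Q x_i
-- Variables of the conclusion: inj₁ i = x_i, inj₂ j = y_j.
record Rule (S : Signature) (nA nP l : ℕ) : Set where
  constructor rule
  field
    posT  : List (Fin l × Act nA)
    posP  : List (Fin l × Fin nP)
    negT  : List (Fin l × Act nA)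
    negP  : List (Fin l × Fin nP)
    concl : Concl S nA nP (Fin l ⊎ Fin (length posT))
open Rule public

-- A preg system: for each operation f, a finite list of rules with source f(x1..xl).
record Preg (S : Signature) (nA nP : ℕ) : Set where
  field
    rules : (f : Fin (nOps S)) → List (Rule S nA nP (arity S f))
open Preg public

GSOS : Signature → ℕ → Set
GSOS S nA = Preg S nA 0

ConclT : ∀ {S nA nP V} → Concl S nA nP V → Act nA → (V → Term S) → Term S → Set
ConclT (trans c' C) c σ t = (c' ≡ c) × (t ≡ inst σ C)
ConclT (pred _)     c σ t = ⊥

ConclP : ∀ {S nA nP V} → Concl S nA nP V → Fin nP → Set
ConclP (trans _ _) P = ⊥
ConclP (pred P')   P = P' ≡ P

vlookup : ∀ {A : Set} {n} → Vec A n → Fin n → A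
vlookup (x ∷ xs) zero    = x
vlookup (x ∷ xs) (suc i) = vlookup xs i

module Sem {S : Signature} {nA nP : ℕ} (R : Preg S nA nP) where
  mutual
    Trans : Term S → Act nA → Term S → Set
    Trans (op f ts) c t =
      Σ[ ρ ∈ Rule S nA nP (arity S f) ] (ρ ∈ rules R f) ×
      Σ[ ys ∈ (Fin (length (posT ρ)) → Term S) ]
        Sat ts ρ ys × ConclT (concl ρ) c [ vlookup ts , ys ] t

    Holds : Term S → Fin nP → Set
    Holds (op f ts) P =
      Σ[ ρ ∈ Rule S nA nP (arity S f) ] (ρ ∈ rules R f) ×
      Σ[ ys ∈ (Fin (length (posT ρ)) → Term S) ]
        Sat ts ρ ys × ConclP (concl ρ) P

    Sat : ∀ {l} → Vec (Term S) l → (ρ : Rule S nA nP l) →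
          (Fin (length (posT ρ)) → Term S) → Set
    Sat ts ρ ys =
      ((j : Fin (length (posT ρ))) →
          TransV ts (proj₁ (lookup (posT ρ) j)) (proj₂ (lookup (posT ρ) j)) (ys j))
      × All (λ q → HoldsV ts (proj₁ q) (proj₂ q)) (posP ρ)
      × All (λ q → ¬ (Σ[ t' ∈ Term S ] TransV ts (proj₁ q) (proj₂ q) t')) (negT ρ)
      × All (λ q → ¬ HoldsV ts (proj₁ q) (proj₂ q)) (negP ρ)

    TransV : ∀ {l} → Vec (Term S) l → Fin l → Act nA → Term S → Set
    TransV (t ∷ ts) zero    = Trans t
    TransV (t ∷ ts) (suc i) = TransV ts i

    HoldsV : ∀ {l} → Vec (Term S) l → Fin l → Fin nP → Set
    HoldsV (t ∷ ts) zero    = Holds t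
    HoldsV (t ∷ ts) (suc i) = HoldsV ts i

-- The positive preg system G⁺ (predicates cannot(a), indexed by a : Act nA)

data Prem (nA l : ℕ) : Set where
  posPrem : Fin l → Act nA → Prem nA l
  negPrem : Fin l → Act nA → Prem nA l

module Plus {S : Signature} {nA : ℕ} (G : GSOS S nA) where

  liftConcl : ∀ {V} → Concl S nA 0 V → Concl S nA (suc nA) V
  liftConcl (trans c C) = trans c C
  liftConcl (pred ())

  -- (i) negative premises x -/a-> become cannot(a) x
  -- (G has no predicates, so its posP / negP lists are necessarily empty.)
  positivise : ∀ {l} → Rule S nA 0 l → Rule S nA (suc nA) l
  positivise ρ = rule (posT ρ) (negT ρ) [] [] (liftConcl (concl ρ))

  label : ∀ {V} → Concl S nA 0 V → Act nA
  label (trans c _) = c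
  label (pred ())

  Rfa : ∀ {l} → List (Rule S nA 0 l) → Act nA → List (Rule S nA 0 l)
  Rfa rs a = filter (λ ρ → label (concl ρ) ≟F a) rs

  prems : ∀ {l} → Rule S nA 0 l → List (Prem nA l)
  prems ρ = map (λ q → posPrem (proj₁ q) (proj₂ q)) (posT ρ)
         ++ map (λ q → negPrem (proj₁ q) (proj₂ q)) (negT ρ)

  -- all ways of choosing one element from each list (the functions φ)
  choices : ∀ {A : Set} → List (List A) → List (List A)
  choices []         = [] ∷ []
  choices (xs ∷ xss) = concatMap (λ x → map (x ∷_) (choices xss)) xs

  -- neg(x -/b->) = x -b-> x'  (fresh distinct targets)
  negPosT : ∀ {l} → List (Prem nA l) → List (Fin l × Act nA)
  negPosT []                 = []
  negPosT (posPrem i a ∷ cs) = negPosT cs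
  negPosT (negPrem i b ∷ cs) = (i , b) ∷ negPosT cs

  -- neg(x -a-> x') = cannot(a) x
  negPosP : ∀ {l} → List (Prem nA l) → List (Fin l × Act nA)
  negPosP []                 = []
  negPosP (posPrem i a ∷ cs) = (i , a) ∷ negPosP cs
  negPosP (negPrem i b ∷ cs) = negPosP cs

  cannotRule : ∀ {l} → Act nA → List (Prem nA l) → Rule S nA (suc nA) l
  cannotRule a cs = rule (negPosT cs) (negPosP cs) [] [] (pred a)

  -- (ii) for constants, (iii) for arity ≥ 1
  gen : ∀ {l} → List (Rule S nA 0 l) → Act nA → List (Rule S nA (suc nA) l)
  gen {zero}  rs a = if null (Rfa rs a) then rule [] [] [] [] (pred a) ∷ [] else []
  gen {suc l} rs a = map (cannotRule a) (choices (map prems (Rfa rs a)))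

  G⁺ : Preg S nA (suc nA)
  rules G⁺ f = map positivise (rules G f) ++ concatMap (gen (rules G f)) (allFin (suc nA))

open Plus public using (G⁺)

module Submission where

-- We prove, by structural induction on closed terms p, that p satisfies the
-- invariant `Agreement`: G and G⁺ derive the same transitions from p, and for
-- every action a the predicate cannot(a) holds of p in G⁺ exactly when p has
-- no a-transition.  For p = f(ts) the induction hypothesis for the arguments
-- ts lets every premise of a rule be transferred between G and G⁺, and lets
-- us decide every premise: either it holds, or its negation neg(π) holds in
-- G⁺.  A rule-by-rule analysis then shows that either some rule in R(f,a)
-- fires, or each of them has a refuted premise; choosing one refuted premise
-- per rule is precisely a choice φ, so the cannot-rule for φ fires.  The
-- constant axioms (ii) are the instance l = 0 of the rules (iii), which is
-- stated as `gen-uniform` and lets both cases be treated at once.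

open import Defs
open import Data.Nat using (ℕ; zero; suc)
open import Data.Empty using (⊥; ⊥-elim)
open import Data.Fin using (Fin; zero; suc)
open import Data.Fin.Properties using () renaming (_≟_ to _≟F_)
open import Data.List using (List; []; _∷_; map; _++_; concatMap; length; allFin; lookup)
open import Data.List.Relation.Unary.All as All using (All; []; _∷_)
import Data.List.Relation.Unary.All.Properties as AllP
open import Data.List.Relation.Unary.Any using (Any; here; there; index)
import Data.List.Relation.Unary.Any.Properties as AnyP
open import Data.List.Membership.Propositional using (_∈_; find; lose)
open import Data.List.Membership.Propositional.Properties
  using (∈-map⁺; ∈-map⁻; ∈-++⁺ˡ; ∈-++⁺ʳ; ∈-++⁻; ∈-concatMap⁺; ∈-concatMap⁻; ∈-filter⁺; ∈-filter⁻; ∈-allFin)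
open import Data.Product using (_×_; Σ; Σ-syntax; _,_; proj₁; proj₂)
open import Data.Sum using (_⊎_; inj₁; inj₂; [_,_]; map₂; fromInj₂)
open import Data.Vec using (Vec; []; _∷_)
open import Function.Bundles using (_⇔_; mk⇔)
open import Relation.Binary.PropositionalEquality using (_≡_; refl; sym; cong; subst)
open import Relation.Nullary using (¬_)

record Agreement {T A : Set} (Tr Tr⁺ : A → T → Set) (Cannot : A → Set) : Set where
  field
    trans⁺          : ∀ {a t} → Tr a t → Tr⁺ a t
    trans⁻          : ∀ {a t} → Tr⁺ a t → Tr a t
    cannot-sound    : ∀ {a} → Cannot a → ¬ Σ T (Tr a)
    cannot-complete : ∀ a → Σ T (Tr a) ⊎ Cannot a

  cannot-of-absence : ∀ {a} → ¬ Σ T (Tr a) → Cannot a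
  cannot-of-absence {a} none = fromInj₂ (λ tr → ⊥-elim (none tr)) (cannot-complete a)

-- Sem.Trans R (op f ts) and Sem.Holds R (op f ts)
-- are definitionally TransBy ts (rules R f) and HoldsBy ts (rules R f).
module RuleListSemantics {S : Signature} {nA nP : ℕ} (R : Preg S nA nP) where
  open Sem R

  TransBy : ∀ {l} → Vec (Term S) l → List (Rule S nA nP l) → Act nA → Term S → Set
  TransBy ts rs c t =
    Σ[ ρ ∈ Rule S nA nP _ ] (ρ ∈ rs) ×
    Σ[ ys ∈ (Fin (length (posT ρ)) → Term S) ] Sat ts ρ ys × ConclT (concl ρ) c [ vlookup ts , ys ] t

  HoldsBy : ∀ {l} → Vec (Term S) l → List (Rule S nA nP l) → Fin nP → Set
  HoldsBy ts rs P =
    Σ[ ρ ∈ Rule S nA nP _ ] (ρ ∈ rs) ×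
    Σ[ ys ∈ (Fin (length (posT ρ)) → Term S) ] Sat ts ρ ys × ConclP (concl ρ) P

no-predicate-premises : ∀ {X : Set} {P : X × Fin 0 → Set} (xs : List (X × Fin 0)) → All P xs
no-predicate-premises []             = []
no-predicate-premises ((_ , ()) ∷ _)

module Correctness {S : Signature} {nA : ℕ} (G : GSOS S nA) where
  open Plus G hiding (G⁺)
  module SG = Sem G
  module S⁺ = Sem (G⁺ G)
  open RuleListSemantics G using () renaming (TransBy to TransByG)
  open RuleListSemantics (G⁺ G) using () renaming (TransBy to TransBy⁺; HoldsBy to HoldsBy⁺)

  -- The rules G⁺ gives an operation whose G-rules are rs;
  -- rules (G⁺ G) f is definitionally rules⁺ (rules G f).
  rules⁺ : ∀ {l} → List (Rule S nA 0 l) → List (Rule S nA (suc nA) l)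
  rules⁺ rs = map positivise rs ++ concatMap (gen rs) (allFin (suc nA))

  conclT-lift : ∀ {V} (κ : Concl S nA 0 V) {a σ t} → ConclT κ a σ t → ConclT (liftConcl κ) a σ t
  conclT-lift (trans _ _) c = c
  conclT-lift (pred ())

  conclT-unlift : ∀ {V} (κ : Concl S nA 0 V) {a σ t} → ConclT (liftConcl κ) a σ t → ConclT κ a σ t
  conclT-unlift (trans _ _) c = c
  conclT-unlift (pred ())

  liftConcl-no-pred : ∀ {V} (κ : Concl S nA 0 V) {a} → ¬ ConclP (liftConcl κ) a
  liftConcl-no-pred (trans _ _) ()
  liftConcl-no-pred (pred ())

  conclT-label : ∀ {V} (κ : Concl S nA 0 V) {a σ t} → ConclT κ a σ t → label κ ≡ a
  conclT-label (trans _ _) (eq , _) = eq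
  conclT-label (pred ())

  conclT-exists : ∀ {V} (κ : Concl S nA 0 V) {a} → label κ ≡ a →
                  (σ : V → Term S) → Σ[ t ∈ Term S ] ConclT κ a σ t
  conclT-exists (trans c C) eq σ = inst σ C , eq , refl
  conclT-exists (pred ())

  ∈-Rfa⁺ : ∀ {l} {rs : List (Rule S nA 0 l)} {a ρ} → ρ ∈ rs → label (concl ρ) ≡ a → ρ ∈ Rfa rs a
  ∈-Rfa⁺ {a = a} m eq = ∈-filter⁺ (λ ρ → label (concl ρ) ≟F a) m eq

  ∈-Rfa⁻ : ∀ {l} (rs : List (Rule S nA 0 l)) {a ρ} → ρ ∈ Rfa rs a → ρ ∈ rs × label (concl ρ) ≡ a
  ∈-Rfa⁻ rs {a} = ∈-filter⁻ (λ ρ → label (concl ρ) ≟F a) {xs = rs}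

  prems-nullary : (ρ : Rule S nA 0 0) → prems ρ ≡ []
  prems-nullary (rule [] _ [] _ _)            = refl
  prems-nullary (rule ((() , _) ∷ _) _ _ _ _)
  prems-nullary (rule [] _ ((() , _) ∷ _) _ _)

  -- The axiom (ii) for constants is the case l = 0 of the rules (iii): with
  -- R(f,a) empty there is exactly one (empty) choice φ, otherwise none, since
  -- the rules in R(f,a) have no premises to choose from.
  gen-uniform : ∀ {l} (rs : List (Rule S nA 0 l)) a →
                gen rs a ≡ map (cannotRule a) (choices (map prems (Rfa rs a)))
  gen-uniform {suc l} rs a = refl
  gen-uniform {zero}  rs a with Rfa rs a
  ... | []    = refl
  ... | ρ ∷ _ = cong (λ ps → map (cannotRule a) (concatMap _ ps)) (sym (prems-nullary ρ))

  gen-member⁻ : ∀ {l} (rs : List (Rule S nA 0 l)) a {ρ} → ρ ∈ gen rs a →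
    Σ[ cs ∈ List (Prem nA l) ] cs ∈ choices (map prems (Rfa rs a)) × ρ ≡ cannotRule a cs
  gen-member⁻ rs a m = ∈-map⁻ (cannotRule a) (subst (_ ∈_) (gen-uniform rs a) m)

  gen-member⁺ : ∀ {l} (rs : List (Rule S nA 0 l)) a {cs} →
    cs ∈ choices (map prems (Rfa rs a)) → cannotRule a cs ∈ gen rs a
  gen-member⁺ rs a m = subst (_ ∈_) (sym (gen-uniform rs a)) (∈-map⁺ (cannotRule a) m)

  rules⁺-cases : ∀ {l} (rs : List (Rule S nA 0 l)) {ρ} → ρ ∈ rules⁺ rs →
    (Σ[ ρ₀ ∈ Rule S nA 0 l ] ρ₀ ∈ rs × ρ ≡ positivise ρ₀) ⊎ (Σ[ b ∈ Act nA ] ρ ∈ gen rs b)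
  rules⁺-cases rs m with ∈-++⁻ (map positivise rs) m
  ... | inj₁ m′ = inj₁ (∈-map⁻ positivise m′)
  ... | inj₂ m′ with find (∈-concatMap⁻ (gen rs) {xs = allFin (suc nA)} m′)
  ...   | b , _ , mb = inj₂ (b , mb)

  gen-concl : ∀ {l} (rs : List (Rule S nA 0 l)) b {ρ} → ρ ∈ gen rs b → concl ρ ≡ pred b
  gen-concl rs b m with gen-member⁻ rs b m
  ... | _ , _ , refl = refl

  choices-All⁻ : ∀ {A : Set} {P : A → Set} {cs} (xss : List (List A)) →
                 cs ∈ choices xss → All P cs → All (Any P) xss
  choices-All⁻ [] _ _ = []
  choices-All⁻ {A} {P} {cs} (xs ∷ xss) m ps =
    from-head xs ps (∈-concatMap⁻ (λ x → map (x ∷_) (choices xss)) {xs = xs} m)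
    where
    from-head : ∀ ys → All P cs → Any (λ x → cs ∈ map (x ∷_) (choices xss)) ys →
                All (Any P) (ys ∷ xss)
    from-head (y ∷ _) ps (here m′) with ∈-map⁻ (y ∷_) m′
    from-head (y ∷ _) (p ∷ ps) (here m′) | cs′ , m″ , refl = here p ∷ choices-All⁻ xss m″ ps
    from-head (y ∷ ys) ps (there m′) with from-head ys ps m′
    ... | q ∷ qs = there q ∷ qs

  choices-All⁺ : ∀ {A : Set} {P : A → Set} (xss : List (List A)) → All (Any P) xss →
                 Σ[ cs ∈ List A ] cs ∈ choices xss × All P cs
  choices-All⁺ [] [] = [] , here refl , []
  choices-All⁺ (xs ∷ xss) (a ∷ as) with choices-All⁺ xss as | find a
  ... | cs , m , ps | x , mx , px = x ∷ cs , extend xs mx , px ∷ ps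
    where
    extend : ∀ ys → x ∈ ys → (x ∷ cs) ∈ concatMap (λ y → map (y ∷_) (choices xss)) ys
    extend (y ∷ ys) (here refl) = ∈-++⁺ˡ (∈-map⁺ (y ∷_) m)
    extend (y ∷ ys) (there mx′) = ∈-++⁺ʳ (map (y ∷_) (choices xss)) (extend ys mx′)

  Agrees : Term S → Set
  Agrees p = Agreement (SG.Trans p) (S⁺.Trans p) (S⁺.Holds p)

  ArgsAgree : ∀ {l} → Vec (Term S) l → Set
  ArgsAgree ts = ∀ i → Agreement (SG.TransV ts i) (S⁺.TransV ts i) (S⁺.HoldsV ts i)

  module Premises {l} (ts : Vec (Term S) l) (ih : ArgsAgree ts) where
    open Agreement

    -- neg(π) holds in G⁺ at the arguments ts.
    Refuted : Prem nA l → Set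
    Refuted (posPrem i b) = S⁺.HoldsV ts i b
    Refuted (negPrem i b) = Σ (Term S) (S⁺.TransV ts i b)

    positivise-sat⁺ : (ρ : Rule S nA 0 l) (ys : Fin (length (posT ρ)) → Term S) →
                      SG.Sat ts ρ ys → S⁺.Sat ts (positivise ρ) ys
    positivise-sat⁺ ρ ys (pos , _ , neg , _) =
      (λ j → trans⁺ (ih _) (pos j)) ,
      All.map (λ {q} none → cannot-of-absence (ih (proj₁ q)) none) neg , [] , []

    positivise-sat⁻ : (ρ : Rule S nA 0 l) (ys : Fin (length (posT ρ)) → Term S) →
                      S⁺.Sat ts (positivise ρ) ys → SG.Sat ts ρ ys
    positivise-sat⁻ ρ ys (pos , cannot , _ , _) =
      (λ j → trans⁻ (ih _) (pos j)) , no-predicate-premises (posP ρ) ,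
      All.map (λ {q} → cannot-sound (ih (proj₁ q))) cannot , no-predicate-premises (negP ρ)

    cannotRule-sat⁺ : ∀ a cs → All Refuted cs → Σ[ ys ∈ _ ] S⁺.Sat ts (cannotRule a cs) ys
    cannotRule-sat⁺ a [] [] = (λ ()) , (λ ()) , [] , [] , []
    cannotRule-sat⁺ a (posPrem i b ∷ cs) (h ∷ hs) with cannotRule-sat⁺ a cs hs
    ... | ys , pos , cannot , _ = ys , pos , h ∷ cannot , [] , []
    cannotRule-sat⁺ a (negPrem i b ∷ cs) ((t , tr) ∷ hs) with cannotRule-sat⁺ a cs hs
    ... | ys , pos , cannot , _ =
      (λ { zero → t ; (suc j) → ys j }) , (λ { zero → tr ; (suc j) → pos j }) , cannot , [] , []

    cannotRule-sat⁻ : ∀ a cs ys → S⁺.Sat ts (cannotRule a cs) ys → All Refuted cs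
    cannotRule-sat⁻ a [] ys _ = []
    cannotRule-sat⁻ a (posPrem i b ∷ cs) ys (pos , h ∷ cannot , _) =
      h ∷ cannotRule-sat⁻ a cs ys (pos , cannot , [] , [])
    cannotRule-sat⁻ a (negPrem i b ∷ cs) ys (pos , cannot , _) =
      (ys zero , pos zero) ∷
      cannotRule-sat⁻ a cs (λ j → ys (suc j)) ((λ j → pos (suc j)) , cannot , [] , [])

    positive-premises-decide : (ps : List (Fin l × Act nA)) →
      (Σ[ ys ∈ (Fin (length ps) → Term S) ]
         ((j : Fin (length ps)) → SG.TransV ts (proj₁ (lookup ps j)) (proj₂ (lookup ps j)) (ys j)))
      ⊎ Any (λ q → S⁺.HoldsV ts (proj₁ q) (proj₂ q)) ps
    positive-premises-decide [] = inj₁ ((λ ()) , (λ ()))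
    positive-premises-decide ((i , b) ∷ ps) with cannot-complete (ih i) b
    ... | inj₂ h = inj₂ (here h)
    ... | inj₁ (t , tr) with positive-premises-decide ps
    ...   | inj₂ refuted = inj₂ (there refuted)
    ...   | inj₁ (ys , pos) =
      inj₁ ((λ { zero → t ; (suc j) → ys j }) , (λ { zero → tr ; (suc j) → pos j }))

    negative-premises-decide : (ns : List (Fin l × Act nA)) →
      All (λ q → ¬ Σ (Term S) (SG.TransV ts (proj₁ q) (proj₂ q))) ns
      ⊎ Any (λ q → Σ (Term S) (S⁺.TransV ts (proj₁ q) (proj₂ q))) ns
    negative-premises-decide [] = inj₁ []
    negative-premises-decide ((i , b) ∷ ns) with cannot-complete (ih i) b
    ... | inj₁ (t , tr) = inj₂ (here (t , trans⁺ (ih i) tr))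
    ... | inj₂ h with negative-premises-decide ns
    ...   | inj₂ refuted = inj₂ (there refuted)
    ...   | inj₁ hold = inj₁ (cannot-sound (ih i) h ∷ hold)

    fires-or-refuted : (ρ : Rule S nA 0 l) →
      (Σ[ ys ∈ (Fin (length (posT ρ)) → Term S) ] SG.Sat ts ρ ys) ⊎ Any Refuted (prems ρ)
    fires-or-refuted ρ with positive-premises-decide (posT ρ) | negative-premises-decide (negT ρ)
    ... | inj₂ refuted | _ = inj₂ (AnyP.++⁺ˡ (AnyP.map⁺ refuted))
    ... | inj₁ _ | inj₂ refuted =
      inj₂ (AnyP.++⁺ʳ (map (λ q → posPrem (proj₁ q) (proj₂ q)) (posT ρ)) (AnyP.map⁺ refuted))
    ... | inj₁ (ys , pos) | inj₁ neg =
      inj₁ (ys , pos , no-predicate-premises (posP ρ) , neg , no-predicate-premises (negP ρ))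

    refuted⇒¬fires : (ρ : Rule S nA 0 l) (ys : Fin (length (posT ρ)) → Term S) →
                     Any Refuted (prems ρ) → ¬ SG.Sat ts ρ ys
    refuted⇒¬fires ρ ys refuted (pos , _ , neg , _)
      with AnyP.++⁻ (map (λ q → posPrem (proj₁ q) (proj₂ q)) (posT ρ)) refuted
    ... | inj₁ r = let j = index (AnyP.map⁻ r) in
      cannot-sound (ih _) (AnyP.lookup-index (AnyP.map⁻ r)) (ys j , pos j)
    ... | inj₂ r with All.lookupAny neg (AnyP.map⁻ r)
    ...   | none , (t , tr) = none (t , trans⁻ (ih _) tr)

    some-fires-or-all-refuted : (rs : List (Rule S nA 0 l)) →
      (Σ[ ρ ∈ Rule S nA 0 l ] ρ ∈ rs × Σ[ ys ∈ (Fin (length (posT ρ)) → Term S) ] SG.Sat ts ρ ys)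
      ⊎ All (λ ρ → Any Refuted (prems ρ)) rs
    some-fires-or-all-refuted [] = inj₂ []
    some-fires-or-all-refuted (ρ ∷ rs) with fires-or-refuted ρ
    ... | inj₁ fires = inj₁ (ρ , here refl , fires)
    ... | inj₂ refuted with some-fires-or-all-refuted rs
    ...   | inj₁ (ρ′ , m , fires) = inj₁ (ρ′ , there m , fires)
    ...   | inj₂ all-refuted = inj₂ (refuted ∷ all-refuted)

  CannotBy : ∀ {l} → Vec (Term S) l → List (Rule S nA 0 l) → Act nA → Set
  CannotBy ts rs a =
    Σ[ ρ ∈ Rule S nA (suc nA) _ ] (ρ ∈ gen rs a) × Σ[ ys ∈ (Fin (length (posT ρ)) → Term S) ] S⁺.Sat ts ρ ys

  holds⁺→cannotBy : ∀ {l} (ts : Vec (Term S) l) rs a → HoldsBy⁺ ts (rules⁺ rs) a → CannotBy ts rs a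
  holds⁺→cannotBy ts rs a (ρ , m , ys , sat , c) with rules⁺-cases rs m
  ... | inj₁ (ρ₀ , _ , refl) = ⊥-elim (liftConcl-no-pred (concl ρ₀) c)
  ... | inj₂ (b , mb) =
    ρ , subst (λ x → ρ ∈ gen rs x) (subst (λ κ → ConclP κ a) (gen-concl rs b mb) c) mb , ys , sat

  cannotBy→holds⁺ : ∀ {l} (ts : Vec (Term S) l) rs a → CannotBy ts rs a → HoldsBy⁺ ts (rules⁺ rs) a
  cannotBy→holds⁺ ts rs a (ρ , m , ys , sat) =
    ρ , ∈-++⁺ʳ (map positivise rs) (∈-concatMap⁺ (gen rs) (lose (∈-allFin a) m)) , ys , sat ,
    subst (λ κ → ConclP κ a) (sym (gen-concl rs a m)) refl

  -- A firing cannot(a)-rule excludes every a-transition in G: it refutes a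
  -- premise of every rule in R(f,a).
  cannotBy-sound : ∀ {l} (ts : Vec (Term S) l) rs a → ArgsAgree ts →
                   CannotBy ts rs a → ¬ Σ (Term S) (TransByG ts rs a)
  cannotBy-sound ts rs a ih (ρ , m , ys , sat) (t , ρ′ , m′ , ys′ , sat′ , c′) with gen-member⁻ rs a m
  ... | cs , mcs , refl =
    refuted⇒¬fires ρ′ ys′ (All.lookup all-refuted (∈-Rfa⁺ m′ (conclT-label (concl ρ′) c′))) sat′
    where
    open Premises ts ih
    all-refuted : All (λ r → Any Refuted (prems r)) (Rfa rs a)
    all-refuted = AllP.map⁻ (choices-All⁻ (map prems (Rfa rs a)) mcs (cannotRule-sat⁻ a cs ys sat))

  -- If no rule in R(f,a) fires, the choice of refuted premises fires a cannot(a)-rule.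
  cannotBy-complete : ∀ {l} (ts : Vec (Term S) l) rs a → ArgsAgree ts →
                      Σ (Term S) (TransByG ts rs a) ⊎ CannotBy ts rs a
  cannotBy-complete ts rs a ih with some-fires-or-all-refuted (Rfa rs a)
    where open Premises ts ih
  ... | inj₁ (ρ , m , ys , sat) with ∈-Rfa⁻ rs m
  ...   | m′ , labelled with conclT-exists (concl ρ) labelled [ vlookup ts , ys ]
  ...     | t , c = inj₁ (t , ρ , m′ , ys , sat , c)
  cannotBy-complete ts rs a ih | inj₂ all-refuted
    with choices-All⁺ (map prems (Rfa rs a)) (AllP.map⁺ all-refuted)
  ... | cs , mcs , refuted with Premises.cannotRule-sat⁺ ts ih a cs refuted
  ...   | ys , sat = inj₂ (cannotRule a cs , gen-member⁺ rs a mcs , ys , sat)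

  -- G⁺-transitions of f(ts) come from positivised rules, whose premises
  -- transfer back to G.
  trans⁺→transG : ∀ {l} (ts : Vec (Term S) l) rs → ArgsAgree ts →
                  ∀ {a t} → TransBy⁺ ts (rules⁺ rs) a t → TransByG ts rs a t
  trans⁺→transG ts rs ih (ρ , m , ys , sat , c) with rules⁺-cases rs m
  ... | inj₁ (ρ₀ , m₀ , refl) =
    ρ₀ , m₀ , ys , Premises.positivise-sat⁻ ts ih ρ₀ ys sat , conclT-unlift (concl ρ₀) c
  trans⁺→transG ts rs ih {a} {t} (ρ , m , ys , sat , c) | inj₂ (b , mb) =
    ⊥-elim (subst (λ κ → ConclT κ a [ vlookup ts , ys ] t) (gen-concl rs b mb) c)

  agreement-step : (f : Fin (nOps S)) (ts : Vec (Term S) (arity S f)) → ArgsAgree ts → Agrees (op f ts)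
  agreement-step f ts ih = record
    { trans⁺ = λ { (ρ , m , ys , sat , c) →
        positivise ρ , ∈-++⁺ˡ (∈-map⁺ positivise m) , ys ,
        Premises.positivise-sat⁺ ts ih ρ ys sat , conclT-lift (concl ρ) c }
    ; trans⁻ = trans⁺→transG ts (rules G f) ih
    ; cannot-sound = λ {a} h → cannotBy-sound ts (rules G f) a ih (holds⁺→cannotBy ts (rules G f) a h)
    ; cannot-complete = λ a →
        map₂ (cannotBy→holds⁺ ts (rules G f) a) (cannotBy-complete ts (rules G f) a ih)
    }

  mutual
    agreement : (p : Term S) → Agrees p
    agreement (op f ts) = agreement-step f ts (args-agree ts)

    args-agree : ∀ {l} (ts : Vec (Term S) l) → ArgsAgree ts
    args-agree (t ∷ ts) zero    = agreement t
    args-agree (t ∷ ts) (suc i) = args-agree ts i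

lemma25 : {S : Signature} {nA : ℕ} (G : GSOS S nA) (p p' : Term S) (a : Act nA) →
    (Sem.Trans G p a p' ⇔ Sem.Trans (G⁺ G) p a p')
    × (Sem.Holds (G⁺ G) p a ⇔ (¬ (Σ[ q ∈ Term S ] Sem.Trans (G⁺ G) p a q)))
    × (Sem.Holds (G⁺ G) p a ⇔ (¬ (Σ[ q ∈ Term S ] Sem.Trans G p a q)))
lemma25 G p p' a =
  mk⇔ trans⁺ trans⁻ ,
  mk⇔ (λ h (q , tr) → cannot-sound h (q , trans⁻ tr))
      (λ none → cannot-of-absence (λ (q , tr) → none (q , trans⁺ tr))) ,
  mk⇔ cannot-sound cannot-of-absence
  where open Agreement (Correctness.agreement G p)
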